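{- If $H$ is an induced subgraph of a graph $G$, then $TTr(H)\le TTr(G)$.
   Context: All graphs are finite and simple. For disjoint vertex sets $A,B$, $A$ dominates $B$ if every vertex of $B$ has a neighbour in $A$. A tournament transitive partition of order $k$ of $G=(V,E)$ is a partition $\{V_1,\dots,V_k\}$ of $V$ into nonempty sets such that for all $1\le i<j\le k$, $V_i$ dominates $V_j$ and $V_j$ does not dominate $V_i$. The tournament transitivity $TTr(G)$ is the maximum $k$ for which such a partition exists. -}

module Defs where

open import Level using (0ℓ)
open import Data.Nat using (ℕ)
open import Data.Fin using (Fin; _<_)
open import Data.Product using (Σ; ∃; _×_)
open import Relation.Binary.PropositionalEquality using (_≡_)
open import Relation.Nullary using (¬_)
open import Function using (_⇔_)
open import Function.Definitions using (Injective)

record Graph : Set₁ where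
  field
    n      : ℕ
    Adj    : Fin n → Fin n → Set
    sym    : ∀ {u v} → Adj u v → Adj v u
    irrefl : ∀ {v} → ¬ Adj v v
open Graph public

-- A partition of V(G) into k classes V_0,...,V_{k-1} given by a class
-- map p : V → Fin k; the class V_i is p⁻¹(i).
-- "V_i dominates V_j": every vertex of V_j has a neighbour in V_i.
Dominates : (G : Graph) {k : ℕ} → (Fin (n G) → Fin k) → Fin k → Fin k → Set
Dominates G p i j =
  ∀ v → p v ≡ j → Σ (Fin (n G)) λ u → p u ≡ i × Adj G v u

IsTTPartition : (G : Graph) (k : ℕ) → (Fin (n G) → Fin k) → Set
IsTTPartition G k p =
  (∀ i → Σ (Fin (n G)) λ v → p v ≡ i) ×
  (∀ i j → i < j → Dominates G p i j × ¬ Dominates G p j i)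

HasTTPartition : Graph → ℕ → Set
HasTTPartition G k = Σ (Fin (n G) → Fin k) λ p → IsTTPartition G k p

IsTTr : Graph → ℕ → Set
IsTTr G t = HasTTPartition G t × (∀ k → HasTTPartition G k → k Data.Nat.≤ t)

IsInducedSubgraph : Graph → Graph → Set
IsInducedSubgraph H G =
  Σ (Fin (n H) → Fin (n G)) λ f →
    Injective _≡_ _≡_ f × (∀ a b → Adj H a b ⇔ Adj G (f a) (f b))

{-# OPTIONS --safe #-}
module Submission where

open import Defs
open import Data.Nat using (ℕ; _≤_; zero; suc; z≤n)
open import Data.Fin using (Fin; zero; _<_)
open import Data.Fin.Properties using (any?; _≟_)
open import Data.Product using (∃; _×_; _,_; proj₁; proj₂)
open import Data.Empty using (⊥-elim)
open import Function using (_⇔_; Equivalence)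
open import Function.Definitions using (Injective)
open import Relation.Nullary using (¬_; yes; no)
open import Relation.Binary.PropositionalEquality using (_≡_; _≢_; refl; trans; cong)

-- A tournament transitive partition of H extends to one of G of the same order
-- by throwing every vertex outside the copy of H into the first class V₀.
-- Only classes V_j with j > 0 ever need to be dominated, and those contain no
-- new vertices; so every domination (or non-domination) in G is witnessed
-- inside H, where adjacency is unchanged.

<⇒≢zero : ∀ {k} {i j : Fin (suc k)} → i < j → j ≢ zero
<⇒≢zero () refl

module _ {m n k : ℕ} (f : Fin m → Fin n) (p : Fin m → Fin (suc k)) where

  extendByZero : Fin n → Fin (suc k)
  extendByZero x with any? (λ a → f a ≟ x)
  ... | yes (a , _) = p a
  ... | no _        = zero

  extendByZero-∘ : Injective _≡_ _≡_ f → ∀ a → extendByZero (f a) ≡ p a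
  extendByZero-∘ inj a with any? (λ b → f b ≟ f a)
  ... | yes (b , fb≡fa) = cong p (inj fb≡fa)
  ... | no ∄b           = ⊥-elim (∄b (a , refl))

  extendByZero-≢zero : ∀ x → extendByZero x ≢ zero →
                       ∃ λ a → f a ≡ x × p a ≡ extendByZero x
  extendByZero-≢zero x ≢zero with any? (λ a → f a ≟ x)
  ... | yes (a , fa≡x) = a , fa≡x , refl
  ... | no _           = ⊥-elim (≢zero refl)

module _ (H G : Graph) (sub : IsInducedSubgraph H G)
         {k : ℕ} (p : Fin (n H) → Fin (suc k)) where

  private
    f : Fin (n H) → Fin (n G)
    f = proj₁ sub

    adj : ∀ a b → Adj H a b ⇔ Adj G (f a) (f b)
    adj = proj₂ (proj₂ sub)

    q : Fin (n G) → Fin (suc k)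
    q = extendByZero f p

    q∘f : ∀ a → q (f a) ≡ p a
    q∘f = extendByZero-∘ f p (proj₁ (proj₂ sub))

    preimage : ∀ {j} x → q x ≡ j → j ≢ zero → ∃ λ a → f a ≡ x × p a ≡ j
    preimage x refl j≢0 = extendByZero-≢zero f p x j≢0

  Dominates-extendByZero : ∀ {i j} → j ≢ zero →
                           Dominates H p i j → Dominates G q i j
  Dominates-extendByZero j≢0 D x qx≡j with preimage x qx≡j j≢0
  ... | a , refl , pa≡j with D a pa≡j
  ... | u , pu≡i , a~u = f u , trans (q∘f u) pu≡i , Equivalence.to (adj a u) a~u

  Dominates-restrict : ∀ {i j} → i ≢ zero →
                       Dominates G q i j → Dominates H p i j
  Dominates-restrict i≢0 D a pa≡j with D (f a) (trans (q∘f a) pa≡j)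
  ... | x , qx≡i , fa~x with preimage x qx≡i i≢0
  ... | u , refl , pu≡i = u , pu≡i , Equivalence.from (adj a u) fa~x

  IsTTPartition-extendByZero : IsTTPartition H (suc k) p →
                               IsTTPartition G (suc k) q
  IsTTPartition-extendByZero (nonempty , transitive) = nonempty′ , transitive′
    where
    nonempty′ : ∀ i → ∃ λ x → q x ≡ i
    nonempty′ i = f (proj₁ (nonempty i)) , trans (q∘f _) (proj₂ (nonempty i))

    transitive′ : ∀ i j → i < j → Dominates G q i j × ¬ Dominates G q j i
    transitive′ i j i<j =
      Dominates-extendByZero (<⇒≢zero i<j) (proj₁ (transitive i j i<j)) ,
      λ D → proj₂ (transitive i j i<j) (Dominates-restrict (<⇒≢zero i<j) D)

HasTTPartition-induced : ∀ H G → IsInducedSubgraph H G →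
                         ∀ {k} → HasTTPartition H (suc k) → HasTTPartition G (suc k)
HasTTPartition-induced H G sub (p , isTT) =
  extendByZero (proj₁ sub) p , IsTTPartition-extendByZero H G sub p isTT

proposition11 : (H G : Graph) → IsInducedSubgraph H G →
    (tH tG : ℕ) → IsTTr H tH → IsTTr G tG → tH ≤ tG
proposition11 H G sub zero    tG _          _             = z≤n
proposition11 H G sub (suc k) tG (hasH , _) (_ , maximal) =
  maximal (suc k) (HasTTPartition-induced H G sub hasH)
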